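{- Let $T$ be a string of length $n$ whose last character occurs nowhere else in $T$, with suffix tree $\mathrm{ST}=(V,E)$ and LZ78 factorization $f_1\cdots f_z$. For any edge $e=(v,w)\in E$, $n_e\le\min(|c(e)|,h(v))$.
   Context: $\mathrm{ST}$ is the compacted trie of all suffixes of $T$; $c(e)$ is the label of edge $e$, $l(v)$ the number of leaves below $v$, and $\mathrm{root}$ the root. The LZ78 trie consists of $\varepsilon$ and the LZ78 factors $f_1,\dots,f_z$ (each $f_x=f'_xc$ with $c$ a character and $f'_x$ the longest string of $\{f_y:y<x\}\cup\{\varepsilon\}$ that is a prefix of the text remaining at the start of $f_x$), each $f_x$ being a child of $f'_x$; its nodes are substrings of $T$, hence correspond to points on $\mathrm{ST}$. For an edge $e=(v,w)$, with $s$ the string spelled from the root to $v$, $n_e$ is the number of LZ78 trie nodes of the form $s\,c(e)[1..k]$ with $1\le k\le|c(e)|$. The function $h:V\to\mathbb{N}_0$ is defined by $h(\mathrm{root})=n$ and $h(v)=\max(0,\min(h(u),l(v))-|c(e)|)$ for every edge $e=(u,v)\in E$. -}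

module Defs where

open import Data.List using (List; []; _∷_; _++_; _∷ʳ_; length; filter; map; upTo; drop; take)
open import Data.List.Properties using (≡-dec)
open import Data.List.Membership.Propositional using (_∈_)
import Data.List.Membership.DecPropositional as DecMem
open import Data.List.Relation.Binary.Prefix.Heterogeneous using (Prefix)
open import Data.List.Relation.Binary.Prefix.Heterogeneous.Properties using (prefix?)
open import Data.Nat using (ℕ; suc; _≤_; _⊓_; _∸_)
open import Data.Product using (∃; ∃₂; _×_)
open import Data.Sum using (_⊎_)
open import Relation.Binary.PropositionalEquality using (_≡_; _≢_)
open import Relation.Binary.Definitions using (DecidableEquality)
open import Relation.Nullary using (¬_)

module _ {A : Set} where

  Substring : List A → List A → Set
  Substring s T = ∃₂ λ u w → u ++ s ++ w ≡ T

  IsSuffix : List A → List A → Set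
  IsSuffix s T = ∃ λ u → u ++ s ≡ T

  IsPrefix : List A → List A → Set
  IsPrefix s t = ∃ λ w → s ++ w ≡ t

  Branching : List A → List A → Set
  Branching T s = ∃₂ λ a b → a ≢ b × Substring (s ∷ʳ a) T × Substring (s ∷ʳ b) T

  -- nodes of the suffix tree ST of T (compacted trie of all suffixes of T),
  -- identified with the string spelled from the root:
  -- the root, the suffixes (leaves), and the branching points.
  STNode : List A → List A → Set
  STNode T s = s ≡ [] ⊎ (IsSuffix s T ⊎ Branching T s)

  -- STEdge T v c : there is an edge e = (v , v ++ c) of ST with label c(e) = c,
  -- i.e. both ends are nodes, c is nonempty, and no node lies strictly between.
  STEdge : List A → List A → List A → Set
  STEdge T v c = STNode T v × STNode T (v ++ c) × c ≢ [] ×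
    (∀ p q → p ≢ [] → q ≢ [] → p ++ q ≡ c → ¬ STNode T (v ++ p))

  -- LZ78 prev rem fs : fs is the LZ78 factorization of the remaining text rem,
  -- given that the previously produced factors are prev.
  data LZ78 : List (List A) → List A → List (List A) → Set where
    done : ∀ {prev} → LZ78 prev [] []
    step : ∀ {prev rem rest fs} (f' : List A) (c : A) →
           f' ∈ ([] ∷ prev) →
           f' ++ (c ∷ rest) ≡ rem →
           (∀ g → g ∈ ([] ∷ prev) → IsPrefix g rem → length g ≤ length f') →
           LZ78 (prev ∷ʳ (f' ∷ʳ c)) rest fs →
           LZ78 prev rem ((f' ∷ʳ c) ∷ fs)

  LZ78Factorization : List A → List (List A) → Set
  LZ78Factorization T fs = LZ78 [] T fs

module WithDec {A : Set} (_≟_ : DecidableEquality A) where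

  open DecMem (≡-dec _≟_) using (_∈?_)

  -- the nonempty suffixes of T (the leaves of ST; the last character of T is unique)
  suffixes : List A → List (List A)
  suffixes T = map (λ i → drop i T) (upTo (length T))

  -- l(v): number of leaves of ST below v
  leaves : List A → List A → ℕ
  leaves T v = length (filter (λ s → prefix? _≟_ v s) (suffixes T))

  -- n_e for the edge e = (v , v ++ c): number of LZ78 trie nodes of the form
  -- v ++ c[1..k] with 1 ≤ k ≤ |c|  (fs = the LZ78 factors; ε never has this form)
  nₑ : List (List A) → List A → List A → ℕ
  nₑ fs v c = length (filter (λ k → (v ++ take k c) ∈? fs) (map suc (upTo (length c))))

  -- h satisfies the defining recursion of the paper on ST of T:
  -- h(root) = n and h(w) = max(0, min(h(u), l(w)) - |c(e)|) for every edge e = (u,w)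
  IsH : List A → (List A → ℕ) → Set
  IsH T h = (h [] ≡ length T) ×
            (∀ u c → STEdge T u c → h (u ++ c) ≡ (h u ⊓ leaves T (u ++ c)) ∸ length c)

-- The LZ78 factors form a prefix-closed set, and distinct factors start at distinct positions of T.
-- For a node v of ST, count the distinct factors strictly below v.  At the root there are at most n
-- of them, one per position.  If e = (u , w) is an edge and some factor lies strictly below w, then
-- by prefix closure all |c(e)| points of e are factors too; these and the factors below w lie below
-- u, and, since no suffix branches or ends inside e, every occurrence of each of them is an
-- occurrence of w, so there are at most l(w) of them.  Hence at most min(h(u), l(w)) - |c(e)| = h(w)
-- factors lie strictly below w, and n_e is at most h(v) by the bound at v.
module Submission where

open import Defs
open import Data.Bool using (true; false)
open import Data.Empty using (⊥-elim)
open import Data.List using (List; []; _∷_; _++_; _∷ʳ_; [_]; length; map; filter; upTo; applyUpTo; take; drop)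
open import Data.List.Membership.Propositional using (_∈_; _∉_)
open import Data.List.Membership.Propositional.Properties
  using (∈-++⁻; ∈-++⁺ˡ; ∈-++⁺ʳ; ∈-applyUpTo⁻; ∈-filter⁻)
import Data.List.Membership.DecPropositional as DecMembership
open import Data.List.Properties
  using (++-assoc; ++-identityʳ; ++-conicalˡ; ++-conicalʳ; ∷-injective; ≡-dec; length-++; length-++-≤ˡ; length-++-≤ʳ;
         length-map; length-take; length-filter; length-applyUpTo; length-upTo; filter-accept; map-applyUpTo; map-upTo;
         take++drop≡id)
open import Data.List.Relation.Binary.Prefix.Heterogeneous using (Prefix)
import Data.List.Relation.Binary.Prefix.Heterogeneous as Prefix
open import Data.List.Relation.Binary.Prefix.Heterogeneous.Properties using (prefix?)
open import Data.List.Relation.Binary.Subset.Propositional using (_⊆_)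
open import Data.List.Relation.Unary.All as All using (All)
import Data.List.Relation.Unary.All.Properties as All
open import Data.List.Relation.Unary.AllPairs using (_∷_)
open import Data.List.Relation.Unary.Any using (here; there)
open import Data.List.Relation.Unary.Unique.Propositional using (Unique)
import Data.List.Relation.Unary.Unique.Propositional.Properties as Unique
open import Data.Nat using (ℕ; suc; _≤_; _<_; _+_; _⊓_; z≤n; s≤s; _≤?_)
open import Data.Nat.Properties
  using (n≤1+n; ≤-refl; ≤-reflexive; ≤-trans; ≤-pred; <-trans; <-≤-trans; ≤-<-trans; <⇒≢; <⇒≱; m<m+n; m≤n⇒m⊓n≡m;
         +-cancelˡ-≡; +-comm; suc-injective; ⊓-glb; m+n≤o⇒m≤o∸n; module ≤-Reasoning)
open import Data.Product using (∃; ∃₂; _×_; _,_; proj₁; proj₂)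
open import Data.Sum using (_⊎_; inj₁; inj₂; [_,_]′)
open import Effect.Monad using (RawMonad)
open import Function using (_∘_)
open import Level using (0ℓ)
open import Relation.Binary.Definitions using (DecidableEquality)
open import Relation.Binary.PropositionalEquality using (_≡_; _≢_; refl; sym; trans; cong; subst)
open import Relation.Nullary using (¬_; Dec; yes; no; does)
open import Relation.Nullary.Decidable using (decidable-stable; ¬¬-excluded-middle)
open import Relation.Nullary.Negation using (¬¬-Monad; ¬¬-map)
open import Relation.Unary using (Pred; Decidable)

open RawMonad (¬¬-Monad {0ℓ}) using (pure; _>>=_)

module _ {X : Set} where

  Unique-remove : ∀ {x} {S : List X} → Unique S → x ∈ S →
                  ∃ λ S′ → length S ≡ suc (length S′) × Unique S′ × S′ ⊆ S × x ∉ S′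
  Unique-remove (x≢ ∷ S!) (here refl) = _ , refl , S! , there , λ x∈ → All.lookup x≢ x∈ refl
  Unique-remove (y≢ ∷ S!) (there x∈S) with Unique-remove S! x∈S
  ... | S′ , |S|≡ , S′! , S′⊆S , x∉S′ =
    _ ∷ S′ , cong suc |S|≡ , All.tabulate (All.lookup y≢ ∘ S′⊆S) ∷ S′! ,
    (λ { (here refl) → here refl ; (there z∈S′) → there (S′⊆S z∈S′) }) ,
    λ { (here refl) → All.lookup y≢ x∈S refl ; (there x∈S′) → x∉S′ x∈S′ }

  filter-map : ∀ {B : Set} {P : Pred B 0ℓ} (P? : Decidable P) (f : X → B) xs →
               filter P? (map f xs) ≡ map f (filter (P? ∘ f) xs)
  filter-map P? f [] = refl
  filter-map P? f (x ∷ xs) with does (P? (f x))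
  ... | true = cong (f x ∷_) (filter-map P? f xs)
  ... | false = filter-map P? f xs

module _ {A : Set} where

  infix 4 _⊏_

  _⊏_ : List A → List A → Set
  u ⊏ x = ∃ λ y → y ≢ [] × u ++ y ≡ x

  ⊏⇒IsPrefix : ∀ {u x} → u ⊏ x → IsPrefix u x
  ⊏⇒IsPrefix (y , _ , e) = y , e

  ⊏⇒≢[] : ∀ {u x} → u ⊏ x → x ≢ []
  ⊏⇒≢[] {u} (y , y≢[] , refl) = y≢[] ∘ ++-conicalʳ u y

  ⊏-trans : ∀ {u v x} → u ⊏ v → v ⊏ x → u ⊏ x
  ⊏-trans {u} (y , y≢[] , refl) (y′ , _ , refl) =
    y ++ y′ , y≢[] ∘ ++-conicalˡ y y′ , sym (++-assoc u y y′)

  IsPrefix-trans : ∀ {x y z : List A} → IsPrefix x y → IsPrefix y z → IsPrefix x z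
  IsPrefix-trans {x} (w , refl) (w′ , refl) = w ++ w′ , sym (++-assoc x w w′)

  IsPrefix-∷ʳ : ∀ x (a : A) w → IsPrefix (x ∷ʳ a) (x ++ a ∷ w)
  IsPrefix-∷ʳ x a w = w , ++-assoc x [ a ] w

  IsPrefix-∷ʳ⁻ : ∀ x f (a : A) → IsPrefix x (f ∷ʳ a) → x ≡ f ∷ʳ a ⊎ IsPrefix x f
  IsPrefix-∷ʳ⁻ [] f a _ = inj₂ (f , refl)
  IsPrefix-∷ʳ⁻ (y ∷ x) [] a (w , e) with ∷-injective e
  ... | refl , x++w≡[] rewrite ++-conicalˡ x w x++w≡[] = inj₁ refl
  IsPrefix-∷ʳ⁻ (y ∷ x) (z ∷ f) a (w , e) with ∷-injective e
  ... | refl , x++w≡ with IsPrefix-∷ʳ⁻ x f a (w , x++w≡)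
  ...   | inj₁ refl = inj₁ refl
  ...   | inj₂ (w′ , e′) = inj₂ (w′ , cong (y ∷_) e′)

  ⊏⇒length-< : ∀ {u x} → u ⊏ x → length u < length x
  ⊏⇒length-< {u} ([] , y≢[] , _) = ⊥-elim (y≢[] refl)
  ⊏⇒length-< {u} (b ∷ y , _ , refl) =
    subst (length u <_) (sym (length-++ u)) (m<m+n (length u) (s≤s z≤n))

  length-<-++ʳ : ∀ {p} (q : List A) → p ≢ [] → length q < length (p ++ q)
  length-<-++ʳ {[]} q p≢[] = ⊥-elim (p≢[] refl)
  length-<-++ʳ {_ ∷ p} q _ = s≤s (length-++-≤ʳ q {p})

  ⊏⇒¬IsPrefix : ∀ {u x} → u ⊏ x → ¬ IsPrefix x u
  ⊏⇒¬IsPrefix {x = x} u⊏x (w , refl) = <⇒≱ (⊏⇒length-< u⊏x) (length-++-≤ˡ x)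

  IsSuffix-++ : ∀ {s ys} (xs : List A) → IsSuffix s ys → IsSuffix s (xs ++ ys)
  IsSuffix-++ {s} xs (u , e) = xs ++ u , trans (++-assoc xs u s) (cong (xs ++_) e)

  Substring-IsPrefix : ∀ {x y T : List A} → IsPrefix x y → Substring y T → Substring x T
  Substring-IsPrefix {x} (w , refl) (u , v , refl) = u , w ++ v , cong (u ++_) (sym (++-assoc x w v))

  IsSuffix⇒Substring : ∀ {s T : List A} → IsSuffix s T → Substring s T
  IsSuffix⇒Substring {s} (u , e) = u , [] , trans (cong (u ++_) (++-identityʳ s)) e

  STNode⇒Substring : ∀ {T s} → STNode T s → Substring s T
  STNode⇒Substring {T} (inj₁ refl) = [] , T , refl
  STNode⇒Substring (inj₂ (inj₁ s-suffix)) = IsSuffix⇒Substring s-suffix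
  STNode⇒Substring (inj₂ (inj₂ (a , _ , _ , sa-occurs , _))) = Substring-IsPrefix ([ a ] , refl) sa-occurs

  PrefixClosed : List (List A) → Set
  PrefixClosed fs = ∀ {x y} → x ≢ [] → IsPrefix x y → y ∈ fs → x ∈ fs

  PrefixClosed-∷ʳ : ∀ {prev f} a → PrefixClosed prev → f ∈ [] ∷ prev → PrefixClosed (prev ∷ʳ (f ∷ʳ a))
  PrefixClosed-∷ʳ {prev} {f} a closed f∈ {x} x≢[] x⊑y y∈ with ∈-++⁻ prev y∈
  ... | inj₁ y∈prev = ∈-++⁺ˡ (closed x≢[] x⊑y y∈prev)
  ... | inj₂ (here refl) with IsPrefix-∷ʳ⁻ x f a x⊑y | f∈
  ...   | inj₁ refl | _ = ∈-++⁺ʳ prev (here refl)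
  ...   | inj₂ (w , x++w≡[]) | here refl = ⊥-elim (x≢[] (++-conicalˡ x w x++w≡[]))
  ...   | inj₂ x⊑f | there f∈prev = ∈-++⁺ˡ (closed x≢[] x⊑f f∈prev)

  LZ78⇒PrefixClosed : ∀ {prev rem fs} → PrefixClosed prev → LZ78 prev rem fs → PrefixClosed (prev ++ fs)
  LZ78⇒PrefixClosed {prev} closed done = subst PrefixClosed (sym (++-identityʳ prev)) closed
  LZ78⇒PrefixClosed {prev} closed (step {fs = fs} f c f∈ _ _ factorization) =
    subst PrefixClosed (++-assoc prev [ f ∷ʳ c ] fs)
      (LZ78⇒PrefixClosed (PrefixClosed-∷ʳ c closed f∈) factorization)

  data Reachable (T : List A) : List A → Set where
    root : Reachable T []
    _▹_  : ∀ {u c} → Reachable T u → STEdge T u c → Reachable T (u ++ c)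

  Reachable⇒STNode : ∀ {T v} → Reachable T v → STNode T v
  Reachable⇒STNode root = inj₁ refl
  Reachable⇒STNode (_ ▹ e) = proj₁ (proj₂ e)

  -- Whether a node lies strictly inside the segment from u to u ++ w is not decidable from the
  -- definitions, hence the double negation; n bounds |w|.
  reachable-below : ∀ {T} n {u} w → length w ≤ n → Reachable T u → STNode T (u ++ w) →
                    ¬ ¬ Reachable T (u ++ w)
  reachable-below n [] _ u-reachable _ = pure (subst (Reachable _) (sym (++-identityʳ _)) u-reachable)
  reachable-below {T} (suc n) {u} w@(_ ∷ _) (s≤s |w|≤n) u-reachable uw-node = ¬¬-excluded-middle >>= split
    where
    shorter : ∀ (r : List A) → length r < length w → length r ≤ n
    shorter _ r<w = ≤-pred (<-≤-trans r<w (s≤s |w|≤n))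

    split : Dec (∃₂ λ p q → p ≢ [] × q ≢ [] × p ++ q ≡ w × STNode T (u ++ p)) → ¬ ¬ Reachable T (u ++ w)
    split (no no-inner-node) =
      pure (u-reachable ▹ (Reachable⇒STNode u-reachable , uw-node , (λ ()) ,
                           λ p q p≢[] q≢[] e up-node → no-inner-node (p , q , p≢[] , q≢[] , e , up-node)))
    split (yes (p , q , p≢[] , q≢[] , pq≡w , up-node)) = do
      up-reachable ← reachable-below n p (shorter p (⊏⇒length-< (q , q≢[] , pq≡w))) u-reachable up-node
      upq-reachable ← reachable-below n q (shorter q q<w) up-reachable (subst (STNode T) (sym upq≡uw) uw-node)
      pure (subst (Reachable T) upq≡uw upq-reachable)
      where
      upq≡uw : (u ++ p) ++ q ≡ u ++ w
      upq≡uw = trans (++-assoc u p q) (cong (u ++_) pq≡w)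
      q<w : length q < length w
      q<w = subst (λ z → length q < length z) pq≡w (length-<-++ʳ q p≢[])

  reachable : ∀ {T v} → STNode T v → ¬ ¬ Reachable T v
  reachable {v = v} = reachable-below (length v) v ≤-refl root

  edgePoints : List A → List A → List (List A)
  edgePoints u c = applyUpTo (λ i → u ++ take (suc i) c) (length c)

  length-edgePoints : ∀ u c → length (edgePoints u c) ≡ length c
  length-edgePoints u c = length-applyUpTo _ (length c)

  edgePoints-unique : ∀ u c → Unique (edgePoints u c)
  edgePoints-unique u c = Unique.applyUpTo⁺₁ _ (length c) λ i<j j<c eq →
    <⇒≢ i<j (suc-injective (+-cancelˡ-≡ (length u) _ _
      (trans (sym (length-point (<-trans i<j j<c))) (trans (cong length eq) (length-point j<c)))))
    where
    length-point : ∀ {i} → i < length c → length (u ++ take (suc i) c) ≡ length u + suc i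
    length-point i<c = trans (length-++ u) (cong (length u +_) (trans (length-take _ c) (m≤n⇒m⊓n≡m i<c)))

  ∈-edgePoints⁻ : ∀ u c {x} → x ∈ edgePoints u c → ∃₂ λ p q → p ≢ [] × p ++ q ≡ c × u ++ p ≡ x
  ∈-edgePoints⁻ u c x∈ with ∈-applyUpTo⁻ _ x∈
  ∈-edgePoints⁻ u (a ∷ c) x∈ | i , _ , refl =
    take (suc i) (a ∷ c) , drop (suc i) (a ∷ c) , (λ ()) , take++drop≡id (suc i) (a ∷ c) , refl

  ∈-edgePoints⇒⊏ : ∀ u c {x} → x ∈ edgePoints u c → u ⊏ x
  ∈-edgePoints⇒⊏ u c x∈ with ∈-edgePoints⁻ u c x∈
  ... | p , _ , p≢[] , _ , refl = p , p≢[] , refl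

  ∈-edgePoints⇒IsPrefix : ∀ u c {x} → x ∈ edgePoints u c → IsPrefix x (u ++ c)
  ∈-edgePoints⇒IsPrefix u c x∈ with ∈-edgePoints⁻ u c x∈
  ... | p , q , _ , refl , refl = q , ++-assoc u p q

module _ {A : Set} (_≟_ : DecidableEquality A) where

  open WithDec _≟_
  open DecMembership (≡-dec _≟_) using (_∈?_)

  nₑ≡length-filter : ∀ fs v c → nₑ fs v c ≡ length (filter (_∈? fs) (edgePoints v c))
  nₑ≡length-filter fs v c = begin
    nₑ fs v c                                     ≡⟨ sym (length-map point (filter _ ks)) ⟩
    length (map point (filter ((_∈? fs) ∘ point) ks)) ≡⟨ cong length (filter-map (_∈? fs) point ks) ⟨
    length (filter (_∈? fs) (map point ks))       ≡⟨ cong (length ∘ filter (_∈? fs)) points ⟩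
    length (filter (_∈? fs) (edgePoints v c))     ∎
    where
    open Relation.Binary.PropositionalEquality.≡-Reasoning
    point : ℕ → List A
    point k = v ++ take k c
    ks : List ℕ
    ks = map suc (upTo (length c))
    points : map point ks ≡ edgePoints v c
    points = trans (cong (map point) (map-upTo suc (length c))) (map-applyUpTo suc point (length c))

  IsPrefix⇒Prefix : ∀ {x y : List A} → IsPrefix x y → Prefix _≡_ x y
  IsPrefix⇒Prefix {[]} _ = Prefix.[]
  IsPrefix⇒Prefix {a ∷ x} (w , refl) = refl Prefix.∷ IsPrefix⇒Prefix (w , refl)

  suffixes-∷ : ∀ a (xs : List A) → suffixes (a ∷ xs) ≡ (a ∷ xs) ∷ suffixes xs
  suffixes-∷ a xs = cong ((a ∷ xs) ∷_)
    (trans (map-applyUpTo suc (λ i → drop i (a ∷ xs)) (length xs))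
           (sym (map-applyUpTo (λ i → i) (λ i → drop i xs) (length xs))))

  leaves-∷ : ∀ p a xs → leaves (a ∷ xs) p ≡ length (filter (prefix? _≟_ p) ((a ∷ xs) ∷ suffixes xs))
  leaves-∷ p a xs = cong (length ∘ filter (prefix? _≟_ p)) (suffixes-∷ a xs)

  leaves-∷-≤ : ∀ p a xs → leaves xs p ≤ leaves (a ∷ xs) p
  leaves-∷-≤ p a xs rewrite leaves-∷ p a xs with does (prefix? _≟_ p (a ∷ xs))
  ... | true = n≤1+n _
  ... | false = ≤-refl

  leaves-∷-< : ∀ {p a xs} → IsPrefix p (a ∷ xs) → leaves xs p < leaves (a ∷ xs) p
  leaves-∷-< {p} {a} {xs} p⊑ =
    subst (leaves xs p <_) (sym (trans (leaves-∷ p a xs)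
      (cong length (filter-accept (prefix? _≟_ p) (IsPrefix⇒Prefix p⊑))))) ≤-refl

  leaves-++-≤ : ∀ p xs ys → leaves ys p ≤ leaves (xs ++ ys) p
  leaves-++-≤ p [] ys = ≤-refl
  leaves-++-≤ p (a ∷ xs) ys = ≤-trans (leaves-++-≤ p xs ys) (leaves-∷-≤ p a (xs ++ ys))

  leaves-++∷-≤ : ∀ p xs a ys → leaves ys p ≤ leaves (xs ++ a ∷ ys) p
  leaves-++∷-≤ p xs a ys = ≤-trans (leaves-∷-≤ p a ys) (leaves-++-≤ p xs (a ∷ ys))

  leaves-++∷-< : ∀ {p} xs a ys → IsPrefix p (xs ++ a ∷ ys) → leaves ys p < leaves (xs ++ a ∷ ys) p
  leaves-++∷-< [] a ys p⊑ = leaves-∷-< p⊑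
  leaves-++∷-< {p} (b ∷ xs) a ys p⊑ = ≤-<-trans (leaves-++∷-≤ p xs a ys) (leaves-∷-< p⊑)

  leaves≤length : ∀ T p → leaves T p ≤ length T
  leaves≤length T p = ≤-trans (length-filter (prefix? _≟_ p) (suffixes T))
    (≤-reflexive (trans (length-map (λ i → drop i T) (upTo (length T))) (length-upTo (length T))))

  Below : List A → List A → List A → Set
  Below T x p = ∀ {s} → IsSuffix s T → IsPrefix x s → IsPrefix p s

  IsPrefix⇒Below : ∀ {T x p} → IsPrefix p x → Below T x p
  IsPrefix⇒Below p⊑x _ x⊑s = IsPrefix-trans p⊑x x⊑s

  Below-++∷ : ∀ {x p} xs a {ys} → Below (xs ++ a ∷ ys) x p → Below ys x p
  Below-++∷ xs a below s-suffix = below (IsSuffix-++ xs (IsSuffix-++ [ a ] s-suffix))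

  -- A string that continues past the end of the inner point u ++ p of an edge, or differently from
  -- the edge label, would make u ++ p a suffix or a branching point, i.e. a node.
  Below-edge-end : ∀ {T u c} → STEdge T u c → ∀ p q → p ≢ [] → p ++ q ≡ c → Below T (u ++ p) (u ++ c)
  Below-edge-end {u = u} _ p [] _ refl _ up⊑s = subst (λ z → IsPrefix (u ++ z) _) (sym (++-identityʳ p)) up⊑s
  Below-edge-end {u = u} (_ , _ , _ , no-inner-node) p (b ∷ q) p≢[] refl (t , ts≡T) ([] , up≡s) =
    ⊥-elim (no-inner-node p (b ∷ q) p≢[] (λ ()) refl
      (inj₂ (inj₁ (t , trans (cong (t ++_) (trans (sym (++-identityʳ (u ++ p))) up≡s)) ts≡T))))
  Below-edge-end {T} {u} E@(_ , uc-node , _ , no-inner-node) p (b ∷ q) p≢[] refl s-suffix (a ∷ w , up⊑s)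
    with a ≟ b
  ... | yes refl =
    Below-edge-end E (p ∷ʳ a) q (p≢[] ∘ ++-conicalˡ p [ a ]) (++-assoc p [ a ] q) s-suffix
      (subst (λ z → IsPrefix z _) (++-assoc u p [ a ]) (subst (IsPrefix _) up⊑s (IsPrefix-∷ʳ (u ++ p) a w)))
  ... | no a≢b =
    ⊥-elim (no-inner-node p (b ∷ q) p≢[] (λ ()) refl (inj₂ (inj₂ (a , b , a≢b , upa-occurs , upb-occurs))))
    where
    upa-occurs : Substring ((u ++ p) ∷ʳ a) T
    upa-occurs = Substring-IsPrefix (subst (IsPrefix _) up⊑s (IsPrefix-∷ʳ (u ++ p) a w))
                   (IsSuffix⇒Substring s-suffix)
    upb-occurs : Substring ((u ++ p) ∷ʳ b) T
    upb-occurs = Substring-IsPrefix (subst (IsPrefix _) (++-assoc u p (b ∷ q)) (IsPrefix-∷ʳ (u ++ p) b q))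
                   (STNode⇒Substring uc-node)

  ∈-edgePoints⇒Below : ∀ {T u c x} → STEdge T u c → x ∈ edgePoints u c → Below T x (u ++ c)
  ∈-edgePoints⇒Below {u = u} {c} E x∈ with ∈-edgePoints⁻ u c x∈
  ... | p , q , p≢[] , pq≡c , refl = Below-edge-end E p q p≢[] pq≡c

  -- Distinct factors start at distinct positions, i.e. at distinct leaves.
  factors≤leaves : ∀ {prev rem fs p S} → LZ78 prev rem fs → Unique S → S ⊆ fs →
                   All (λ x → Below rem x p) S → length S ≤ leaves rem p
  factors≤leaves {S = []} _ _ _ _ = z≤n
  factors≤leaves {S = _ ∷ _} done _ S⊆[] _ with S⊆[] (here refl)
  ... | ()
  factors≤leaves {p = p} {S} (step {rest = rest} f c _ refl _ factorization) S! S⊆ S-below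
    with (f ∷ʳ c) ∈? S
  ... | no F∉S = ≤-trans (factors≤leaves factorization S! S⊆rest (All.map (Below-++∷ f c) S-below))
                         (leaves-++∷-≤ p f c rest)
    where
    S⊆rest : S ⊆ _
    S⊆rest x∈S with S⊆ x∈S
    ... | here refl = ⊥-elim (F∉S x∈S)
    ... | there x∈ = x∈
  ... | yes F∈S with Unique-remove S! F∈S
  ...   | S′ , |S|≡ , S′! , S′⊆S , F∉S′ =
    subst (_≤ _) (sym |S|≡)
      (<-≤-trans (s≤s (factors≤leaves factorization S′! S′⊆rest S′-below))
                 (leaves-++∷-< f c rest (All.lookup S-below F∈S ([] , refl) (IsPrefix-∷ʳ f c rest))))
    where
    S′⊆rest : S′ ⊆ _
    S′⊆rest x∈S′ with S⊆ (S′⊆S x∈S′)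
    ... | here refl = ⊥-elim (F∉S′ x∈S′)
    ... | there x∈ = x∈
    S′-below : All (λ x → Below rest x p) S′
    S′-below = All.tabulate (Below-++∷ f c ∘ All.lookup S-below ∘ S′⊆S)

  module _ {T fs h} (factorization : LZ78Factorization T fs) (isH : IsH T h) where

    HBound : List A → Set
    HBound v = ∀ {S} → Unique S → S ⊆ fs → All (v ⊏_) S → length S ≤ h v

    HBound-root : HBound []
    HBound-root {S} S! S⊆ _ = begin
      length S    ≤⟨ factors≤leaves factorization S! S⊆ (All.tabulate λ {x} _ → IsPrefix⇒Below (x , refl)) ⟩
      leaves T [] ≤⟨ leaves≤length T [] ⟩
      length T    ≡⟨ proj₁ isH ⟨
      h []        ∎
      where open ≤-Reasoning

    -- The points of the edge are factors by prefix closure, as they lie above some factor in S.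
    HBound-edge : ∀ {u c} → STEdge T u c → HBound u → HBound (u ++ c)
    HBound-edge _ _ {[]} _ _ _ = z≤n
    HBound-edge {u} {c} E@(_ , _ , c≢[] , _) u-bound {S@(_ ∷ _)} S! S⊆ S-below =
      subst (length S ≤_) (sym (proj₂ isH u c E)) (m+n≤o⇒m≤o∸n (length S) (begin
        length S + length c      ≡⟨ +-comm (length S) (length c) ⟩
        length c + length S      ≡⟨ cong (_+ length S) (length-edgePoints u c) ⟨
        length points + length S ≡⟨ length-++ points ⟨
        length (points ++ S)     ≤⟨ ⊓-glb (u-bound S′! S′⊆ S′-below-u)
                                          (factors≤leaves factorization S′! S′⊆ S′-below-uc) ⟩
        h u ⊓ leaves T (u ++ c)  ∎))
      where
      open ≤-Reasoning
      points = edgePoints u c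
      points⊆fs : points ⊆ fs
      points⊆fs x∈ = LZ78⇒PrefixClosed (λ _ _ ()) factorization (⊏⇒≢[] (∈-edgePoints⇒⊏ u c x∈))
        (IsPrefix-trans (∈-edgePoints⇒IsPrefix u c x∈) (⊏⇒IsPrefix (All.lookup S-below (here refl))))
        (S⊆ (here refl))
      S′! : Unique (points ++ S)
      S′! = Unique.++⁺ (edgePoints-unique u c) S!
        λ (x∈points , x∈S) → ⊏⇒¬IsPrefix (All.lookup S-below x∈S) (∈-edgePoints⇒IsPrefix u c x∈points)
      S′⊆ : points ++ S ⊆ fs
      S′⊆ = [ points⊆fs , S⊆ ]′ ∘ ∈-++⁻ points
      S′-below-u : All (u ⊏_) (points ++ S)
      S′-below-u = All.++⁺ (All.tabulate (∈-edgePoints⇒⊏ u c))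
                           (All.map (⊏-trans (c , c≢[] , refl)) S-below)
      S′-below-uc : All (λ x → Below T x (u ++ c)) (points ++ S)
      S′-below-uc = All.++⁺ (All.tabulate (∈-edgePoints⇒Below E))
                            (All.map (IsPrefix⇒Below ∘ ⊏⇒IsPrefix) S-below)

    Reachable⇒HBound : ∀ {v} → Reachable T v → HBound v
    Reachable⇒HBound root = HBound-root
    Reachable⇒HBound (r ▹ E) = HBound-edge E (Reachable⇒HBound r)

    nₑ≤h : ∀ {v} c → Reachable T v → nₑ fs v c ≤ h v
    nₑ≤h {v} c r = subst (_≤ h v) (sym (nₑ≡length-filter fs v c))
      (Reachable⇒HBound r (Unique.filter⁺ (_∈? fs) (edgePoints-unique v c))
        (proj₂ ∘ ∈-filter⁻ (_∈? fs) {xs = points})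
        (All.tabulate (∈-edgePoints⇒⊏ v c ∘ proj₁ ∘ ∈-filter⁻ (_∈? fs) {xs = points})))
      where
      points = edgePoints v c

  nₑ≤length : ∀ fs v c → nₑ fs v c ≤ length c
  nₑ≤length fs v c = subst (_≤ length c) (sym (nₑ≡length-filter fs v c))
    (≤-trans (length-filter (_∈? fs) (edgePoints v c)) (≤-reflexive (length-edgePoints v c)))

lemma4 : (A : Set) (_≟_ : DecidableEquality A) (T' : List A) (a : A) → a ∉ T' →
         (fs : List (List A)) → LZ78Factorization (T' ∷ʳ a) fs →
         (h : List A → ℕ) → WithDec.IsH _≟_ (T' ∷ʳ a) h →
         ∀ v c → STEdge (T' ∷ʳ a) v c →
         WithDec.nₑ _≟_ fs v c ≤ length c ⊓ h v
lemma4 A _≟_ T' a _ fs factorization h isH v c E =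
  ⊓-glb (nₑ≤length _≟_ fs v c)
        (decidable-stable (_ ≤? h v) (¬¬-map (nₑ≤h _≟_ factorization isH c) (reachable (proj₁ E))))
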